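{- Let $\mathcal{C}$ be a monoidal dagger category. The assignments $B\mapsto -\otimes B$ and $T\mapsto T(I)$ define an equivalence between the category of Frobenius monoids in $\mathcal{C}$ (with monoid homomorphisms) and the category of strong Frobenius monads on $\mathcal{C}$ (with morphisms of strong monads).
   Context: A dagger category has an identity-on-objects contravariant functor $f\mapsto f^\dagger$ with $f^{\dagger\dagger}=f$; a morphism $f$ is unitary if $f^\dagger=f^{ -1}$. A monoidal dagger category is a monoidal category with a dagger such that $(f\otimes g)^\dagger=f^\dagger\otimes g^\dagger$ and associators $\alpha$ and unitors $\lambda,\rho$ are unitary. A monoid $(B,m,e)$ is a Frobenius monoid if $(\mathrm{id}\otimes m)\circ(m^\dagger\otimes\mathrm{id})=(m\otimes\mathrm{id})\circ(\mathrm{id}\otimes m^\dagger)$ (modulo associators). A Frobenius monad on $\mathcal{C}$ is a monad $(T,\mu,\eta)$ with $T(f^\dagger)=T(f)^\dagger$ for all $f$ and $T(\mu_A)\circ\mu^\dagger_{T(A)}=\mu_{T(A)}\circ T(\mu_A^\dagger)$ for all $A$. A strong monad is a monad with a natural transformation $\mathrm{st}_{A,B}\colon A\otimes T(B)\to T(A\otimes B)$ satisfying $\mathrm{st}\circ\alpha=T(\alpha)\circ\mathrm{st}\circ(\mathrm{id}\otimes\mathrm{st})$, $T(\lambda)\circ\mathrm{st}=\lambda$, $\mathrm{st}\circ(\mathrm{id}\otimes\mu)=\mu\circ T(\mathrm{st})\circ\mathrm{st}$ and $\mathrm{st}\circ(\mathrm{id}\otimes\eta)=\eta$. A strong Frobenius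 monad is a Frobenius monad that is a strong monad with every $\mathrm{st}_{A,B}$ unitary. A morphism of strong monads is a natural transformation $\beta\colon T\to S$ commuting with units, multiplications, and strengths ($\beta\circ\mathrm{st}=\mathrm{st}\circ(\mathrm{id}\otimes\beta)$). For a Frobenius monoid $B$, $-\otimes B$ is a monad with $\mu_A=\mathrm{id}_A\otimes m$ and $\eta_A=\mathrm{id}_A\otimes e$ and strength given by associators (modulo coherence). For a strong monad $T$, $T(I)$ is a monoid with multiplication $\mu_I\circ T(\rho_{T(I)})\circ\mathrm{st}_{T(I),I}$ and unit $\eta_I$. -}

module Defs where

open import Level using (Level; _⊔_) renaming (suc to lsuc)
open import Relation.Binary using (Rel; IsEquivalence)

record MonoidalDaggerCategory (o ℓ e : Level) : Set (lsuc (o ⊔ ℓ ⊔ e)) where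
  infixr 9 _∘_
  infix  4 _≈_
  infixr 10 _⊗₀_ _⊗₁_
  infix  11 _†
  infix  4 _⇒_
  field
    Obj : Set o
    _⇒_ : Obj → Obj → Set ℓ
    _≈_ : ∀ {A B} → Rel (A ⇒ B) e
    id  : ∀ {A} → A ⇒ A
    _∘_ : ∀ {A B C} → B ⇒ C → A ⇒ B → A ⇒ C
    ≈-equiv   : ∀ {A B} → IsEquivalence (_≈_ {A} {B})
    ∘-resp-≈  : ∀ {A B C} {f h : B ⇒ C} {g i : A ⇒ B} → f ≈ h → g ≈ i → f ∘ g ≈ h ∘ i
    assoc     : ∀ {A B C D} {f : A ⇒ B} {g : B ⇒ C} {h : C ⇒ D} → (h ∘ g) ∘ f ≈ h ∘ (g ∘ f)
    identityˡ : ∀ {A B} {f : A ⇒ B} → id ∘ f ≈ f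
    identityʳ : ∀ {A B} {f : A ⇒ B} → f ∘ id ≈ f
    _†  : ∀ {A B} → A ⇒ B → B ⇒ A
    †-resp-≈       : ∀ {A B} {f g : A ⇒ B} → f ≈ g → f † ≈ g †
    †-identity     : ∀ {A} → id {A} † ≈ id
    †-homomorphism : ∀ {A B C} {f : A ⇒ B} {g : B ⇒ C} → (g ∘ f) † ≈ f † ∘ g †
    †-involutive   : ∀ {A B} {f : A ⇒ B} → f † † ≈ f
    _⊗₀_ : Obj → Obj → Obj
    _⊗₁_ : ∀ {A B C D} → A ⇒ B → C ⇒ D → A ⊗₀ C ⇒ B ⊗₀ D
    ⊗-identity     : ∀ {A B} → id {A} ⊗₁ id {B} ≈ id
    ⊗-homomorphism : ∀ {A B C D E F} {f : A ⇒ B} {f′ : B ⇒ C} {g : D ⇒ E} {g′ : E ⇒ F}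
                     → (f′ ∘ f) ⊗₁ (g′ ∘ g) ≈ (f′ ⊗₁ g′) ∘ (f ⊗₁ g)
    ⊗-resp-≈       : ∀ {A B C D} {f f′ : A ⇒ B} {g g′ : C ⇒ D} → f ≈ f′ → g ≈ g′ → f ⊗₁ g ≈ f′ ⊗₁ g′
    I   : Obj
    α⇒  : ∀ {A B C} → (A ⊗₀ B) ⊗₀ C ⇒ A ⊗₀ (B ⊗₀ C)
    λ⇒  : ∀ {A} → I ⊗₀ A ⇒ A
    ρ⇒  : ∀ {A} → A ⊗₀ I ⇒ A
    α-natural : ∀ {A A′ B B′ C C′} {f : A ⇒ A′} {g : B ⇒ B′} {h : C ⇒ C′}
                → α⇒ ∘ ((f ⊗₁ g) ⊗₁ h) ≈ (f ⊗₁ (g ⊗₁ h)) ∘ α⇒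
    λ-natural : ∀ {A B} {f : A ⇒ B} → λ⇒ ∘ (id {I} ⊗₁ f) ≈ f ∘ λ⇒
    ρ-natural : ∀ {A B} {f : A ⇒ B} → ρ⇒ ∘ (f ⊗₁ id {I}) ≈ f ∘ ρ⇒
    pentagon  : ∀ {A B C D}
                → (id {A} ⊗₁ α⇒ {B} {C} {D}) ∘ α⇒ {A} {B ⊗₀ C} {D} ∘ (α⇒ {A} {B} {C} ⊗₁ id {D})
                  ≈ α⇒ {A} {B} {C ⊗₀ D} ∘ α⇒ {A ⊗₀ B} {C} {D}
    triangle  : ∀ {A B} → (id {A} ⊗₁ λ⇒ {B}) ∘ α⇒ {A} {I} {B} ≈ ρ⇒ {A} ⊗₁ id {B}
    †-⊗ : ∀ {A B C D} {f : A ⇒ B} {g : C ⇒ D} → (f ⊗₁ g) † ≈ (f †) ⊗₁ (g †)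
    -- associators and unitors are isomorphisms and unitary (inverse = dagger)
    α-unitaryˡ : ∀ {A B C} → α⇒ {A} {B} {C} † ∘ α⇒ ≈ id
    α-unitaryʳ : ∀ {A B C} → α⇒ {A} {B} {C} ∘ α⇒ † ≈ id
    λ-unitaryˡ : ∀ {A} → λ⇒ {A} † ∘ λ⇒ ≈ id
    λ-unitaryʳ : ∀ {A} → λ⇒ {A} ∘ λ⇒ † ≈ id
    ρ-unitaryˡ : ∀ {A} → ρ⇒ {A} † ∘ ρ⇒ ≈ id
    ρ-unitaryʳ : ∀ {A} → ρ⇒ {A} ∘ ρ⇒ † ≈ id

module _ {o ℓ e} (𝒞 : MonoidalDaggerCategory o ℓ e) where
  open MonoidalDaggerCategory 𝒞

  record MonoidData : Set (o ⊔ ℓ) where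
    field
      Carrier : Obj
      mult    : Carrier ⊗₀ Carrier ⇒ Carrier
      unit    : I ⇒ Carrier

  record IsFrobeniusMonoid (M : MonoidData) : Set e where
    open MonoidData M
    field
      m-assoc   : mult ∘ (mult ⊗₁ id) ≈ mult ∘ (id ⊗₁ mult) ∘ α⇒
      m-unitˡ   : mult ∘ (unit ⊗₁ id) ≈ λ⇒
      m-unitʳ   : mult ∘ (id ⊗₁ unit) ≈ ρ⇒
      frobenius : (id ⊗₁ mult) ∘ α⇒ ∘ (mult † ⊗₁ id) ≈ (mult ⊗₁ id) ∘ α⇒ † ∘ (id ⊗₁ mult †)

  record FrobeniusMonoid : Set (o ⊔ ℓ ⊔ e) where
    field
      monoid : MonoidData
      isFrobeniusMonoid : IsFrobeniusMonoid monoid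
    open MonoidData monoid public

  record IsMonoidHom (M N : MonoidData) (f : MonoidData.Carrier M ⇒ MonoidData.Carrier N) : Set e where
    private
      module M = MonoidData M
      module N = MonoidData N
    field
      pres-mult : f ∘ M.mult ≈ N.mult ∘ (f ⊗₁ f)
      pres-unit : f ∘ M.unit ≈ N.unit

  record MonoidHom (M N : FrobeniusMonoid) : Set (ℓ ⊔ e) where
    field
      hom   : FrobeniusMonoid.Carrier M ⇒ FrobeniusMonoid.Carrier N
      isHom : IsMonoidHom (FrobeniusMonoid.monoid M) (FrobeniusMonoid.monoid N) hom

  record MonadData : Set (o ⊔ ℓ) where
    field
      F₀ : Obj → Obj
      F₁ : ∀ {A B} → A ⇒ B → F₀ A ⇒ F₀ B
      μ  : ∀ A → F₀ (F₀ A) ⇒ F₀ A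
      η  : ∀ A → A ⇒ F₀ A
      st : ∀ A B → A ⊗₀ F₀ B ⇒ F₀ (A ⊗₀ B)

  record IsStrongFrobeniusMonad (T : MonadData) : Set (o ⊔ ℓ ⊔ e) where
    open MonadData T
    field
      F-identity     : ∀ {A} → F₁ (id {A}) ≈ id
      F-homomorphism : ∀ {A B C} {f : A ⇒ B} {g : B ⇒ C} → F₁ (g ∘ f) ≈ F₁ g ∘ F₁ f
      F-resp-≈       : ∀ {A B} {f g : A ⇒ B} → f ≈ g → F₁ f ≈ F₁ g
      μ-natural : ∀ {A B} {f : A ⇒ B} → μ B ∘ F₁ (F₁ f) ≈ F₁ f ∘ μ A
      η-natural : ∀ {A B} {f : A ⇒ B} → η B ∘ f ≈ F₁ f ∘ η A
      μ-assoc   : ∀ {A} → μ A ∘ F₁ (μ A) ≈ μ A ∘ μ (F₀ A)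
      μ-unitˡ   : ∀ {A} → μ A ∘ F₁ (η A) ≈ id
      μ-unitʳ   : ∀ {A} → μ A ∘ η (F₀ A) ≈ id
      F-† : ∀ {A B} {f : A ⇒ B} → F₁ (f †) ≈ (F₁ f) †
      frobenius : ∀ {A} → F₁ (μ A) ∘ (μ (F₀ A)) † ≈ μ (F₀ A) ∘ F₁ ((μ A) †)
      st-natural : ∀ {A A′ B B′} {f : A ⇒ A′} {g : B ⇒ B′}
                   → st A′ B′ ∘ (f ⊗₁ F₁ g) ≈ F₁ (f ⊗₁ g) ∘ st A B
      st-α : ∀ {A B C} → F₁ (α⇒ {A} {B} {C}) ∘ st (A ⊗₀ B) C ≈ st A (B ⊗₀ C) ∘ (id ⊗₁ st B C) ∘ α⇒
      st-λ : ∀ {A} → F₁ (λ⇒ {A}) ∘ st I A ≈ λ⇒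
      st-μ : ∀ {A B} → st A B ∘ (id ⊗₁ μ B) ≈ μ (A ⊗₀ B) ∘ F₁ (st A B) ∘ st A (F₀ B)
      st-η : ∀ {A B} → st A B ∘ (id ⊗₁ η B) ≈ η (A ⊗₀ B)
      st-unitaryˡ : ∀ {A B} → (st A B) † ∘ st A B ≈ id
      st-unitaryʳ : ∀ {A B} → st A B ∘ (st A B) † ≈ id

  record StrongFrobeniusMonad : Set (o ⊔ ℓ ⊔ e) where
    field
      monad : MonadData
      isStrongFrobeniusMonad : IsStrongFrobeniusMonad monad
    open MonadData monad public

  record IsStrongMonadMorphism (T S : MonadData)
         (β : ∀ A → MonadData.F₀ T A ⇒ MonadData.F₀ S A) : Set (o ⊔ ℓ ⊔ e) where
    private
      module T = MonadData T
      module S = MonadData S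
    field
      β-natural : ∀ {A B} {f : A ⇒ B} → β B ∘ T.F₁ f ≈ S.F₁ f ∘ β A
      β-η  : ∀ {A} → β A ∘ T.η A ≈ S.η A
      β-μ  : ∀ {A} → β A ∘ T.μ A ≈ S.μ A ∘ S.F₁ (β A) ∘ β (T.F₀ A)
      β-st : ∀ {A B} → β (A ⊗₀ B) ∘ T.st A B ≈ S.st A B ∘ (id ⊗₁ β B)

  record StrongMonadMorphism (T S : StrongFrobeniusMonad) : Set (o ⊔ ℓ ⊔ e) where
    field
      β : ∀ A → StrongFrobeniusMonad.F₀ T A ⇒ StrongFrobeniusMonad.F₀ S A
      isMorphism : IsStrongMonadMorphism (StrongFrobeniusMonad.monad T) (StrongFrobeniusMonad.monad S) β

  tensorMonad : MonoidData → MonadData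
  tensorMonad M = record
    { F₀ = λ A → A ⊗₀ Carrier
    ; F₁ = λ f → f ⊗₁ id
    ; μ  = λ A → (id ⊗₁ mult) ∘ α⇒ {A} {Carrier} {Carrier}
    ; η  = λ A → (id ⊗₁ unit) ∘ ρ⇒ {A} †
    ; st = λ A B → α⇒ {A} {B} {Carrier} †
    }
    where open MonoidData M

  tensorMor : (M N : MonoidData) → MonoidData.Carrier M ⇒ MonoidData.Carrier N
              → ∀ A → MonadData.F₀ (tensorMonad M) A ⇒ MonadData.F₀ (tensorMonad N) A
  tensorMor M N f A = id {A} ⊗₁ f

  monadAtUnit : MonadData → MonoidData
  monadAtUnit T = record
    { Carrier = F₀ I
    ; mult    = μ I ∘ F₁ (ρ⇒ {F₀ I}) ∘ st (F₀ I) I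
    ; unit    = η I
    }
    where open MonadData T

  atUnit : (T S : MonadData) → (∀ A → MonadData.F₀ T A ⇒ MonadData.F₀ S A)
           → MonoidData.Carrier (monadAtUnit T) ⇒ MonoidData.Carrier (monadAtUnit S)
  atUnit T S β = β I

  -- The claim that these assignments define an equivalence of categories
  --   FrobMon(𝒞)  ≃  StrongFrobMnd(𝒞)
  -- (identities and composition in both categories are those of 𝒞,
  --  componentwise for monad morphisms; equality of morphisms is ≈,
  --  componentwise for monad morphisms).

  private
    mon = FrobeniusMonoid.monoid
    mnd = StrongFrobeniusMonad.monad

  record AssignmentsDefineEquivalence : Set (o ⊔ ℓ ⊔ e) where
    field
      F-obj : (B : FrobeniusMonoid) → IsStrongFrobeniusMonad (tensorMonad (FrobeniusMonoid.monoid B))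
      G-obj : (T : StrongFrobeniusMonad) → IsFrobeniusMonoid (monadAtUnit (StrongFrobeniusMonad.monad T))
      F-mor : ∀ {B C : FrobeniusMonoid} (f : MonoidHom B C)
              → IsStrongMonadMorphism (tensorMonad (FrobeniusMonoid.monoid B))
                                      (tensorMonad (FrobeniusMonoid.monoid C))
                                      (tensorMor (mon B) (mon C) (MonoidHom.hom f))
      G-mor : ∀ {T S : StrongFrobeniusMonad} (β : StrongMonadMorphism T S)
              → IsMonoidHom (monadAtUnit (StrongFrobeniusMonad.monad T))
                            (monadAtUnit (StrongFrobeniusMonad.monad S))
                            (atUnit (mnd T) (mnd S) (StrongMonadMorphism.β β))
      -- functoriality of F (for G it holds definitionally: (id)_I = id, (β ∘ γ)_I = β_I ∘ γ_I)
      F-identity     : ∀ {B : FrobeniusMonoid} A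
                       → tensorMor (mon B) (mon B) id A ≈ id
      F-homomorphism : ∀ {B C D : FrobeniusMonoid} (f : MonoidHom B C) (g : MonoidHom C D) A
                       → tensorMor (mon B) (mon D) (MonoidHom.hom g ∘ MonoidHom.hom f) A
                         ≈ tensorMor (mon C) (mon D) (MonoidHom.hom g) A
                           ∘ tensorMor (mon B) (mon C) (MonoidHom.hom f) A
      F-resp-≈       : ∀ {B C : FrobeniusMonoid} (f g : MonoidHom B C) → MonoidHom.hom f ≈ MonoidHom.hom g
                       → ∀ A → tensorMor (mon B) (mon C) (MonoidHom.hom f) A
                               ≈ tensorMor (mon B) (mon C) (MonoidHom.hom g) A
      unitIso    : (B : FrobeniusMonoid) → FrobeniusMonoid.Carrier B ⇒ I ⊗₀ FrobeniusMonoid.Carrier B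
      unitIso⁻¹  : (B : FrobeniusMonoid) → I ⊗₀ FrobeniusMonoid.Carrier B ⇒ FrobeniusMonoid.Carrier B
      unitIso-hom   : (B : FrobeniusMonoid)
                      → IsMonoidHom (FrobeniusMonoid.monoid B)
                                    (monadAtUnit (tensorMonad (FrobeniusMonoid.monoid B))) (unitIso B)
      unitIso⁻¹-hom : (B : FrobeniusMonoid)
                      → IsMonoidHom (monadAtUnit (tensorMonad (FrobeniusMonoid.monoid B)))
                                    (FrobeniusMonoid.monoid B) (unitIso⁻¹ B)
      unitIso-isoˡ  : (B : FrobeniusMonoid) → unitIso⁻¹ B ∘ unitIso B ≈ id
      unitIso-isoʳ  : (B : FrobeniusMonoid) → unitIso B ∘ unitIso⁻¹ B ≈ id
      unitIso-natural : ∀ {B C : FrobeniusMonoid} (f : MonoidHom B C)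
                        → unitIso C ∘ MonoidHom.hom f
                          ≈ atUnit (tensorMonad (mon B)) (tensorMonad (mon C))
                                   (tensorMor (mon B) (mon C) (MonoidHom.hom f)) ∘ unitIso B
      counitIso   : (T : StrongFrobeniusMonad) → ∀ A
                    → StrongFrobeniusMonad.F₀ T A ⇒ A ⊗₀ StrongFrobeniusMonad.F₀ T I
      counitIso⁻¹ : (T : StrongFrobeniusMonad) → ∀ A
                    → A ⊗₀ StrongFrobeniusMonad.F₀ T I ⇒ StrongFrobeniusMonad.F₀ T A
      counitIso-mor   : (T : StrongFrobeniusMonad)
                        → IsStrongMonadMorphism (StrongFrobeniusMonad.monad T)
                            (tensorMonad (monadAtUnit (StrongFrobeniusMonad.monad T))) (counitIso T)
      counitIso⁻¹-mor : (T : StrongFrobeniusMonad)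
                        → IsStrongMonadMorphism (tensorMonad (monadAtUnit (StrongFrobeniusMonad.monad T)))
                            (StrongFrobeniusMonad.monad T) (counitIso⁻¹ T)
      counitIso-isoˡ  : (T : StrongFrobeniusMonad) → ∀ A → counitIso⁻¹ T A ∘ counitIso T A ≈ id
      counitIso-isoʳ  : (T : StrongFrobeniusMonad) → ∀ A → counitIso T A ∘ counitIso⁻¹ T A ≈ id
      counitIso-natural : ∀ {T S : StrongFrobeniusMonad} (β : StrongMonadMorphism T S) → ∀ A
                          → counitIso S A ∘ StrongMonadMorphism.β β A
                            ≈ tensorMor (monadAtUnit (mnd T)) (monadAtUnit (mnd S))
                                        (atUnit (mnd T) (mnd S) (StrongMonadMorphism.β β)) A
                              ∘ counitIso T A

-- The strength makes φ_A = T(ρ) ∘ st_{A,I} : A ⊗ T(I) → T(A) a morphism of strong monads from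
-- - ⊗ T(I) to T, and φ is unitary because st is; hence φ† is a morphism too, and the monoid and
-- Frobenius laws of T(I) are those of T read through φ. Conversely the monad and Frobenius laws of
-- - ⊗ B are those of B, spread over A ⊗ B by the coherence of the associator. The unit of the
-- equivalence is the (unitary) left unitor λ : I ⊗ B → B, and the counit is φ.
module Submission where

open import Relation.Binary.Bundles using (Setoid)
open import Relation.Binary.Structures using (IsEquivalence)
import Relation.Binary.Reasoning.Setoid as SetoidReasoning
open import Defs

module Properties {o ℓ e} (𝒞 : MonoidalDaggerCategory o ℓ e) where
  open MonoidalDaggerCategory 𝒞 public

  private
    variable
      A B C D X Y Z : Obj
      f g h u : A ⇒ B

  hom-setoid : Obj → Obj → Setoid ℓ e
  hom-setoid A B = record { isEquivalence = ≈-equiv {A} {B} }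

  open module Equiv {A B : Obj} = IsEquivalence (≈-equiv {A} {B}) public
    using () renaming (refl to ≈-refl; sym to ≈-sym; trans to ≈-trans)
  open module HomReasoning {A B : Obj} = SetoidReasoning (hom-setoid A B) public
    using (begin_; _∎; step-≈-⟩; step-≈-⟨)

  infixr 4 _⟩∘⟨_ refl⟩∘⟨_ _⟩⊗⟨_
  infixl 5 _⟩∘⟨refl

  _⟩∘⟨_ : {f h : B ⇒ C} {g k : A ⇒ B} → f ≈ h → g ≈ k → f ∘ g ≈ h ∘ k
  _⟩∘⟨_ = ∘-resp-≈

  refl⟩∘⟨_ : {f : B ⇒ C} {g k : A ⇒ B} → g ≈ k → f ∘ g ≈ f ∘ k
  refl⟩∘⟨ p = ≈-refl ⟩∘⟨ p

  _⟩∘⟨refl : {f h : B ⇒ C} {g : A ⇒ B} → f ≈ h → f ∘ g ≈ h ∘ g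
  p ⟩∘⟨refl = p ⟩∘⟨ ≈-refl

  _⟩⊗⟨_ : {f f′ : A ⇒ B} {g g′ : C ⇒ D} → f ≈ f′ → g ≈ g′ → f ⊗₁ g ≈ f′ ⊗₁ g′
  _⟩⊗⟨_ = ⊗-resp-≈

  sym-assoc : h ∘ (g ∘ f) ≈ (h ∘ g) ∘ f
  sym-assoc = ≈-sym assoc

  pullˡ : {a : B ⇒ C} {b : A ⇒ B} {c : A ⇒ C} {f : X ⇒ A} → a ∘ b ≈ c → a ∘ (b ∘ f) ≈ c ∘ f
  pullˡ p = ≈-trans sym-assoc (p ⟩∘⟨refl)

  pushˡ : {a : B ⇒ C} {b : A ⇒ B} {c : A ⇒ C} {f : X ⇒ A} → c ≈ a ∘ b → c ∘ f ≈ a ∘ (b ∘ f)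
  pushˡ p = ≈-sym (pullˡ (≈-sym p))

  pullʳ : {a : B ⇒ C} {b : A ⇒ B} {c : X ⇒ A} {d : X ⇒ B} → b ∘ c ≈ d → (a ∘ b) ∘ c ≈ a ∘ d
  pullʳ p = ≈-trans assoc (refl⟩∘⟨ p)

  extendʳ : {a : B ⇒ C} {b : A ⇒ B} {c : D ⇒ C} {d : A ⇒ D} {f : X ⇒ A}
          → a ∘ b ≈ c ∘ d → a ∘ (b ∘ f) ≈ c ∘ (d ∘ f)
  extendʳ p = ≈-trans (pullˡ p) assoc

  elimʳ : {a : A ⇒ B} {b : A ⇒ A} → b ≈ id → a ∘ b ≈ a
  elimʳ p = ≈-trans (refl⟩∘⟨ p) identityʳ

  elimˡ : {a : A ⇒ A} {b : B ⇒ A} → a ≈ id → a ∘ b ≈ b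
  elimˡ p = ≈-trans (p ⟩∘⟨refl) identityˡ

  cancelˡ : {a : B ⇒ A} {b : A ⇒ B} {f : X ⇒ A} → a ∘ b ≈ id → a ∘ (b ∘ f) ≈ f
  cancelˡ p = ≈-trans (pullˡ p) identityˡ

  cancelʳ : {a : B ⇒ A} {b : A ⇒ B} {f : A ⇒ X} → a ∘ b ≈ id → (f ∘ a) ∘ b ≈ f
  cancelʳ p = ≈-trans (pullʳ p) identityʳ

  ⊗∘⊗ : {f : B ⇒ C} {h : A ⇒ B} {g : Y ⇒ Z} {k : X ⇒ Y} → (f ⊗₁ g) ∘ (h ⊗₁ k) ≈ (f ∘ h) ⊗₁ (g ∘ k)
  ⊗∘⊗ = ≈-sym ⊗-homomorphism

  serialize₁₂ : {f : A ⇒ B} {g : C ⇒ D} → f ⊗₁ g ≈ (f ⊗₁ id) ∘ (id ⊗₁ g)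
  serialize₁₂ = ≈-trans (≈-sym identityʳ ⟩⊗⟨ ≈-sym identityˡ) ⊗-homomorphism

  serialize₂₁ : {f : A ⇒ B} {g : C ⇒ D} → f ⊗₁ g ≈ (id ⊗₁ g) ∘ (f ⊗₁ id)
  serialize₂₁ = ≈-trans (≈-sym identityˡ ⟩⊗⟨ ≈-sym identityʳ) ⊗-homomorphism

  ⊗id-commute : {f : A ⇒ B} {g : C ⇒ D} → (f ⊗₁ id) ∘ (id ⊗₁ g) ≈ (id ⊗₁ g) ∘ (f ⊗₁ id)
  ⊗id-commute = ≈-trans (≈-sym serialize₁₂) serialize₂₁

  id⊗∘id⊗ : {f : B ⇒ C} {g : A ⇒ B} → (id {X} ⊗₁ f) ∘ (id ⊗₁ g) ≈ id ⊗₁ (f ∘ g)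
  id⊗∘id⊗ = ≈-trans ⊗∘⊗ (identityˡ ⟩⊗⟨ ≈-refl)

  ⊗id∘⊗id : {f : B ⇒ C} {g : A ⇒ B} → (f ⊗₁ id {X}) ∘ (g ⊗₁ id) ≈ (f ∘ g) ⊗₁ id
  ⊗id∘⊗id = ≈-trans ⊗∘⊗ (≈-refl ⟩⊗⟨ identityˡ)

  id⊗-† : {f : A ⇒ B} → (id {X} ⊗₁ f) † ≈ id ⊗₁ f †
  id⊗-† = ≈-trans †-⊗ (†-identity ⟩⊗⟨ ≈-refl)

  ⊗id-† : {f : A ⇒ B} → (f ⊗₁ id {X}) † ≈ f † ⊗₁ id
  ⊗id-† = ≈-trans †-⊗ (≈-refl ⟩⊗⟨ †-identity)

  record Unitary {A B : Obj} (u : A ⇒ B) : Set e where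
    field
      unitaryˡ : u † ∘ u ≈ id
      unitaryʳ : u ∘ u † ≈ id
  open Unitary public

  id-unitary : Unitary (id {A})
  id-unitary = record { unitaryˡ = elimˡ †-identity ; unitaryʳ = elimʳ †-identity }

  †-unitary : Unitary u → Unitary (u †)
  †-unitary U = record
    { unitaryˡ = ≈-trans (†-involutive ⟩∘⟨refl) (unitaryʳ U)
    ; unitaryʳ = ≈-trans (refl⟩∘⟨ †-involutive) (unitaryˡ U)
    }

  ∘-unitary : {u : B ⇒ C} {v : A ⇒ B} → Unitary u → Unitary v → Unitary (u ∘ v)
  ∘-unitary {u = u} {v} U V = record
    { unitaryˡ = begin
        (u ∘ v) † ∘ (u ∘ v)   ≈⟨ †-homomorphism ⟩∘⟨refl ⟩
        (v † ∘ u †) ∘ (u ∘ v) ≈⟨ pullʳ (cancelˡ (unitaryˡ U)) ⟩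
        v † ∘ v               ≈⟨ unitaryˡ V ⟩
        id                    ∎
    ; unitaryʳ = begin
        (u ∘ v) ∘ (u ∘ v) †   ≈⟨ refl⟩∘⟨ †-homomorphism ⟩
        (u ∘ v) ∘ (v † ∘ u †) ≈⟨ pullʳ (cancelˡ (unitaryʳ V)) ⟩
        u ∘ u †               ≈⟨ unitaryʳ U ⟩
        id                    ∎
    }

  ⊗-unitary : {u : A ⇒ B} {v : C ⇒ D} → Unitary u → Unitary v → Unitary (u ⊗₁ v)
  ⊗-unitary U V = record
    { unitaryˡ = ≈-trans (†-⊗ ⟩∘⟨refl) (≈-trans ⊗∘⊗ (≈-trans (unitaryˡ U ⟩⊗⟨ unitaryˡ V) ⊗-identity))
    ; unitaryʳ = ≈-trans (refl⟩∘⟨ †-⊗) (≈-trans ⊗∘⊗ (≈-trans (unitaryʳ U ⟩⊗⟨ unitaryʳ V) ⊗-identity))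
    }

  α-unitary : Unitary (α⇒ {A} {B} {C})
  α-unitary = record { unitaryˡ = α-unitaryˡ ; unitaryʳ = α-unitaryʳ }

  λ-unitary : Unitary (λ⇒ {A})
  λ-unitary = record { unitaryˡ = λ-unitaryˡ ; unitaryʳ = λ-unitaryʳ }

  ρ-unitary : Unitary (ρ⇒ {A})
  ρ-unitary = record { unitaryˡ = ρ-unitaryˡ ; unitaryʳ = ρ-unitaryʳ }

  unitary-cancelˡ : {u : B ⇒ C} {f g : A ⇒ B} → Unitary u → u ∘ f ≈ u ∘ g → f ≈ g
  unitary-cancelˡ {u = u} {f} {g} U p = begin
    f             ≈⟨ cancelˡ (unitaryˡ U) ⟨
    u † ∘ (u ∘ f) ≈⟨ refl⟩∘⟨ p ⟩
    u † ∘ (u ∘ g) ≈⟨ cancelˡ (unitaryˡ U) ⟩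
    g             ∎

  unitary-cancelʳ : {u : A ⇒ B} {f g : B ⇒ C} → Unitary u → f ∘ u ≈ g ∘ u → f ≈ g
  unitary-cancelʳ {u = u} {f} {g} U p = begin
    f             ≈⟨ cancelʳ (unitaryʳ U) ⟨
    (f ∘ u) ∘ u † ≈⟨ p ⟩∘⟨refl ⟩
    (g ∘ u) ∘ u † ≈⟨ cancelʳ (unitaryʳ U) ⟩
    g             ∎

  unitary-moveˡ : {u : B ⇒ C} {x : A ⇒ B} {y : A ⇒ C} → Unitary u → u ∘ x ≈ y → x ≈ u † ∘ y
  unitary-moveˡ U p = ≈-trans (≈-sym (cancelˡ (unitaryˡ U))) (refl⟩∘⟨ p)

  unitary-moveʳ : {u : A ⇒ B} {x : B ⇒ C} {y : A ⇒ C} → Unitary u → x ∘ u ≈ y → x ≈ y ∘ u †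
  unitary-moveʳ U p = ≈-trans (≈-sym (cancelʳ (unitaryʳ U))) (p ⟩∘⟨refl)

  unitary-transpose : {u : A ⇒ B} {v : C ⇒ D} {x : C ⇒ A} {y : D ⇒ B} → Unitary u → Unitary v
                    → u ∘ x ≈ y ∘ v → u † ∘ y ≈ x ∘ v †
  unitary-transpose {u = u} {v} {x} {y} U V p = begin
    u † ∘ y               ≈⟨ refl⟩∘⟨ unitary-moveʳ V (≈-sym p) ⟩
    u † ∘ ((u ∘ x) ∘ v †) ≈⟨ refl⟩∘⟨ assoc ⟩
    u † ∘ (u ∘ (x ∘ v †)) ≈⟨ cancelˡ (unitaryˡ U) ⟩
    x ∘ v †               ∎

  unitary-square-† : {u : A ⇒ B} {v : C ⇒ D} {x : C ⇒ A} {y : D ⇒ B} → Unitary u → Unitary v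
                   → u ∘ x ≈ y ∘ v → v ∘ x † ≈ y † ∘ u
  unitary-square-† {u = u} {v} {x} {y} U V p = begin
    v ∘ x †               ≈⟨ refl⟩∘⟨ cancelʳ (unitaryˡ U) ⟨
    v ∘ ((x † ∘ u †) ∘ u) ≈⟨ refl⟩∘⟨ †-homomorphism ⟩∘⟨refl ⟨
    v ∘ ((u ∘ x) † ∘ u)   ≈⟨ refl⟩∘⟨ †-resp-≈ p ⟩∘⟨refl ⟩
    v ∘ ((y ∘ v) † ∘ u)   ≈⟨ refl⟩∘⟨ †-homomorphism ⟩∘⟨refl ⟩
    v ∘ ((v † ∘ y †) ∘ u) ≈⟨ refl⟩∘⟨ assoc ⟩
    v ∘ (v † ∘ (y † ∘ u)) ≈⟨ cancelˡ (unitaryʳ V) ⟩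
    y † ∘ u               ∎

  α†-natural : {f : A ⇒ B} {g : C ⇒ D} {h : X ⇒ Y} → α⇒ † ∘ (f ⊗₁ (g ⊗₁ h)) ≈ ((f ⊗₁ g) ⊗₁ h) ∘ α⇒ †
  α†-natural = unitary-transpose α-unitary α-unitary α-natural

  ρ†-natural : {f : A ⇒ B} → ρ⇒ † ∘ f ≈ (f ⊗₁ id) ∘ ρ⇒ †
  ρ†-natural = unitary-transpose ρ-unitary ρ-unitary ρ-natural

  λ†-natural : {f : A ⇒ B} → λ⇒ † ∘ f ≈ (id ⊗₁ f) ∘ λ⇒ †
  λ†-natural = unitary-transpose λ-unitary λ-unitary λ-natural

  ⊗id-injective : {f g : A ⇒ B} → f ⊗₁ id {I} ≈ g ⊗₁ id → f ≈ g
  ⊗id-injective {f = f} {g} p = unitary-cancelʳ ρ-unitary (begin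
    f ∘ ρ⇒         ≈⟨ ρ-natural ⟨
    ρ⇒ ∘ (f ⊗₁ id) ≈⟨ refl⟩∘⟨ p ⟩
    ρ⇒ ∘ (g ⊗₁ id) ≈⟨ ρ-natural ⟩
    g ∘ ρ⇒         ∎)

  id⊗-injective : {f g : A ⇒ B} → id {I} ⊗₁ f ≈ id ⊗₁ g → f ≈ g
  id⊗-injective {f = f} {g} p = unitary-cancelʳ λ-unitary (begin
    f ∘ λ⇒         ≈⟨ λ-natural ⟨
    λ⇒ ∘ (id ⊗₁ f) ≈⟨ refl⟩∘⟨ p ⟩
    λ⇒ ∘ (id ⊗₁ g) ≈⟨ λ-natural ⟩
    g ∘ λ⇒         ∎)

  -- Kelly's consequences of the pentagon and triangle axioms.
  coherence₂ : (id {A} ⊗₁ ρ⇒ {B}) ∘ α⇒ {A} {B} {I} ≈ ρ⇒ {A ⊗₀ B}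
  coherence₂ = ⊗id-injective (unitary-cancelˡ α-unitary (begin
    α⇒ ∘ (((id ⊗₁ ρ⇒) ∘ α⇒) ⊗₁ id)                    ≈⟨ refl⟩∘⟨ ⊗id∘⊗id ⟨
    α⇒ ∘ ((id ⊗₁ ρ⇒) ⊗₁ id) ∘ (α⇒ ⊗₁ id)              ≈⟨ pullˡ α-natural ⟩
    ((id ⊗₁ (ρ⇒ ⊗₁ id)) ∘ α⇒) ∘ (α⇒ ⊗₁ id)            ≈⟨ assoc ⟩
    (id ⊗₁ (ρ⇒ ⊗₁ id)) ∘ α⇒ ∘ (α⇒ ⊗₁ id)              ≈⟨ (≈-refl ⟩⊗⟨ triangle) ⟩∘⟨refl ⟨
    (id ⊗₁ ((id ⊗₁ λ⇒) ∘ α⇒)) ∘ α⇒ ∘ (α⇒ ⊗₁ id)       ≈⟨ pushˡ (≈-sym id⊗∘id⊗) ⟩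
    (id ⊗₁ (id ⊗₁ λ⇒)) ∘ (id ⊗₁ α⇒) ∘ α⇒ ∘ (α⇒ ⊗₁ id) ≈⟨ refl⟩∘⟨ pentagon ⟩
    (id ⊗₁ (id ⊗₁ λ⇒)) ∘ α⇒ ∘ α⇒                      ≈⟨ extendʳ α-natural ⟨
    α⇒ ∘ ((id ⊗₁ id) ⊗₁ λ⇒) ∘ α⇒                      ≈⟨ refl⟩∘⟨ (⊗-identity ⟩⊗⟨ ≈-refl) ⟩∘⟨refl ⟩
    α⇒ ∘ (id ⊗₁ λ⇒) ∘ α⇒                              ≈⟨ refl⟩∘⟨ triangle ⟩
    α⇒ ∘ (ρ⇒ ⊗₁ id)                                   ∎))

  coherence₁ : λ⇒ {A ⊗₀ B} ∘ α⇒ {I} {A} {B} ≈ λ⇒ ⊗₁ id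
  coherence₁ = ≈-sym (id⊗-injective (unitary-cancelʳ (∘-unitary α-unitary (⊗-unitary α-unitary id-unitary)) (begin
    (id ⊗₁ (λ⇒ ⊗₁ id)) ∘ α⇒ ∘ (α⇒ ⊗₁ id)      ≈⟨ pullˡ (≈-sym α-natural) ⟩
    (α⇒ ∘ ((id ⊗₁ λ⇒) ⊗₁ id)) ∘ (α⇒ ⊗₁ id)    ≈⟨ pullʳ ⊗id∘⊗id ⟩
    α⇒ ∘ (((id ⊗₁ λ⇒) ∘ α⇒) ⊗₁ id)            ≈⟨ refl⟩∘⟨ (triangle ⟩⊗⟨ ≈-refl) ⟩
    α⇒ ∘ ((ρ⇒ ⊗₁ id) ⊗₁ id)                   ≈⟨ α-natural ⟩
    (ρ⇒ ⊗₁ (id ⊗₁ id)) ∘ α⇒                   ≈⟨ (≈-refl ⟩⊗⟨ ⊗-identity) ⟩∘⟨refl ⟩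
    (ρ⇒ ⊗₁ id) ∘ α⇒                           ≈⟨ triangle ⟩∘⟨refl ⟨
    ((id ⊗₁ λ⇒) ∘ α⇒) ∘ α⇒                    ≈⟨ assoc ⟩
    (id ⊗₁ λ⇒) ∘ α⇒ ∘ α⇒                      ≈⟨ refl⟩∘⟨ pentagon ⟨
    (id ⊗₁ λ⇒) ∘ (id ⊗₁ α⇒) ∘ α⇒ ∘ (α⇒ ⊗₁ id) ≈⟨ pullˡ id⊗∘id⊗ ⟩
    (id ⊗₁ (λ⇒ ∘ α⇒)) ∘ α⇒ ∘ (α⇒ ⊗₁ id)       ∎)))

  coherence₃ : λ⇒ {I} ≈ ρ⇒ {I}
  coherence₃ = ⊗id-injective (begin
    λ⇒ ⊗₁ id        ≈⟨ coherence₁ ⟨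
    λ⇒ ∘ α⇒         ≈⟨ id⊗λ≈λ ⟩∘⟨refl ⟨
    (id ⊗₁ λ⇒) ∘ α⇒ ≈⟨ triangle ⟩
    ρ⇒ ⊗₁ id        ∎)
    where
    id⊗λ≈λ : id {I} ⊗₁ λ⇒ {I} ≈ λ⇒ {I ⊗₀ I}
    id⊗λ≈λ = unitary-cancelˡ λ-unitary λ-natural

  coherence₁-inv : (λ⇒ {A} ⊗₁ id {B}) ∘ α⇒ † ≈ λ⇒
  coherence₁-inv = ≈-sym (unitary-moveʳ α-unitary coherence₁)

  coherence₂-inv : α⇒ {A} {B} {I} ∘ ρ⇒ † ≈ id ⊗₁ ρ⇒ †
  coherence₂-inv = begin
    α⇒ ∘ ρ⇒ †                  ≈⟨ unitary-moveˡ (⊗-unitary id-unitary ρ-unitary) coherence₂ ⟩∘⟨refl ⟩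
    ((id ⊗₁ ρ⇒) † ∘ ρ⇒) ∘ ρ⇒ † ≈⟨ cancelʳ ρ-unitaryʳ ⟩
    (id ⊗₁ ρ⇒) †               ≈⟨ id⊗-† ⟩
    id ⊗₁ ρ⇒ †                 ∎

  coherence₂-inv′ : α⇒ {A} {B} {I} † ∘ (id ⊗₁ ρ⇒ †) ≈ ρ⇒ †
  coherence₂-inv′ = begin
    α⇒ † ∘ (id ⊗₁ ρ⇒ †) ≈⟨ refl⟩∘⟨ id⊗-† ⟨
    α⇒ † ∘ (id ⊗₁ ρ⇒) † ≈⟨ †-homomorphism ⟨
    ((id ⊗₁ ρ⇒) ∘ α⇒) † ≈⟨ †-resp-≈ coherence₂ ⟩
    ρ⇒ †                ∎

  triangle-inv : α⇒ {A} {I} {B} ∘ (ρ⇒ † ⊗₁ id) ≈ id ⊗₁ λ⇒ †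
  triangle-inv = begin
    α⇒ ∘ (ρ⇒ † ⊗₁ id)                          ≈⟨ unitary-moveˡ (⊗-unitary id-unitary λ-unitary) triangle ⟩∘⟨refl ⟩
    ((id ⊗₁ λ⇒) † ∘ (ρ⇒ ⊗₁ id)) ∘ (ρ⇒ † ⊗₁ id) ≈⟨ pullʳ ⊗id∘⊗id ⟩
    (id ⊗₁ λ⇒) † ∘ ((ρ⇒ ∘ ρ⇒ †) ⊗₁ id)         ≈⟨ elimʳ (≈-trans (ρ-unitaryʳ ⟩⊗⟨ ≈-refl) ⊗-identity) ⟩
    (id ⊗₁ λ⇒) †                               ≈⟨ id⊗-† ⟩
    id ⊗₁ λ⇒ †                                 ∎

  pentagon-invʳ : α⇒ {A ⊗₀ B} {C} {D} ∘ (α⇒ † ⊗₁ id) ≈ α⇒ † ∘ (id ⊗₁ α⇒) ∘ α⇒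
  pentagon-invʳ = begin
    α⇒ ∘ (α⇒ † ⊗₁ id)
      ≈⟨ unitary-moveˡ α-unitary (≈-sym pentagon) ⟩∘⟨refl ⟩
    (α⇒ † ∘ (id ⊗₁ α⇒) ∘ α⇒ ∘ (α⇒ ⊗₁ id)) ∘ (α⇒ † ⊗₁ id)
      ≈⟨ pullʳ (pullʳ (pullʳ (≈-trans ⊗id∘⊗id (≈-trans (α-unitaryʳ ⟩⊗⟨ ≈-refl) ⊗-identity)))) ⟩
    α⇒ † ∘ (id ⊗₁ α⇒) ∘ α⇒ ∘ id
      ≈⟨ refl⟩∘⟨ refl⟩∘⟨ identityʳ ⟩
    α⇒ † ∘ (id ⊗₁ α⇒) ∘ α⇒ ∎

  pentagon-invˡ : (α⇒ {A} {B} {C} ⊗₁ id {D}) ∘ α⇒ † ≈ α⇒ † ∘ (id ⊗₁ α⇒ †) ∘ α⇒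
  pentagon-invˡ = begin
    (α⇒ ⊗₁ id) ∘ α⇒ †
      ≈⟨ unitary-moveˡ α-unitary (unitary-moveˡ (⊗-unitary id-unitary α-unitary) pentagon) ⟩∘⟨refl ⟩
    (α⇒ † ∘ (id ⊗₁ α⇒) † ∘ α⇒ ∘ α⇒) ∘ α⇒ †
      ≈⟨ pullʳ (pullʳ (pullʳ α-unitaryʳ)) ⟩
    α⇒ † ∘ (id ⊗₁ α⇒) † ∘ α⇒ ∘ id
      ≈⟨ refl⟩∘⟨ id⊗-† ⟩∘⟨ identityʳ ⟩
    α⇒ † ∘ (id ⊗₁ α⇒ †) ∘ α⇒ ∎

module _ {o ℓ e} {𝒞 : MonoidalDaggerCategory o ℓ e} where
  open Properties 𝒞

  inverse-isMonoidHom : {M N : MonoidData 𝒞} {f : MonoidData.Carrier M ⇒ MonoidData.Carrier N}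
                        {g : MonoidData.Carrier N ⇒ MonoidData.Carrier M}
                      → g ∘ f ≈ id → f ∘ g ≈ id → IsMonoidHom 𝒞 M N f → IsMonoidHom 𝒞 N M g
  inverse-isMonoidHom {M} {N} {f} {g} g∘f≈id f∘g≈id f-hom = record
    { pres-mult = begin
        g ∘ N.mult                         ≈⟨ refl⟩∘⟨ elimʳ (≈-trans ⊗∘⊗ (≈-trans (f∘g≈id ⟩⊗⟨ f∘g≈id) ⊗-identity)) ⟨
        g ∘ N.mult ∘ ((f ⊗₁ f) ∘ (g ⊗₁ g)) ≈⟨ refl⟩∘⟨ pullˡ (≈-sym pres-mult) ⟩
        g ∘ (f ∘ M.mult) ∘ (g ⊗₁ g)        ≈⟨ refl⟩∘⟨ assoc ⟩
        g ∘ f ∘ M.mult ∘ (g ⊗₁ g)          ≈⟨ cancelˡ g∘f≈id ⟩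
        M.mult ∘ (g ⊗₁ g)                  ∎
    ; pres-unit = ≈-trans (refl⟩∘⟨ ≈-sym pres-unit) (cancelˡ g∘f≈id)
    }
    where
    module M = MonoidData M
    module N = MonoidData N
    open IsMonoidHom f-hom

  inverse-isStrongMonadMorphism : {S T : MonadData 𝒞} → IsStrongFrobeniusMonad 𝒞 T
                                → {β : ∀ A → MonadData.F₀ S A ⇒ MonadData.F₀ T A}
                                  {γ : ∀ A → MonadData.F₀ T A ⇒ MonadData.F₀ S A}
                                → (∀ A → γ A ∘ β A ≈ id) → (∀ A → β A ∘ γ A ≈ id)
                                → IsStrongMonadMorphism 𝒞 S T β → IsStrongMonadMorphism 𝒞 T S γ
  inverse-isStrongMonadMorphism {S} {T} T-monad {β} {γ} γ∘β≈id β∘γ≈id β-morphism = record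
    { β-natural = γ-natural
    ; β-η = ≈-trans (refl⟩∘⟨ ≈-sym β-η) (cancelˡ (γ∘β≈id _))
    ; β-μ = γ-μ
    ; β-st = γ-st
    }
    where
    module S = MonadData S
    module T = MonadData T
    module T-monad = IsStrongFrobeniusMonad T-monad
    open IsStrongMonadMorphism β-morphism

    γ-natural : ∀ {A B} {f : A ⇒ B} → γ B ∘ T.F₁ f ≈ S.F₁ f ∘ γ A
    γ-natural {f = f} = begin
      γ _ ∘ T.F₁ f               ≈⟨ refl⟩∘⟨ elimʳ (β∘γ≈id _) ⟨
      γ _ ∘ T.F₁ f ∘ β _ ∘ γ _   ≈⟨ refl⟩∘⟨ pullˡ (≈-sym β-natural) ⟩
      γ _ ∘ (β _ ∘ S.F₁ f) ∘ γ _ ≈⟨ refl⟩∘⟨ assoc ⟩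
      γ _ ∘ β _ ∘ S.F₁ f ∘ γ _   ≈⟨ cancelˡ (γ∘β≈id _) ⟩
      S.F₁ f ∘ γ _               ∎

    γ-μ : ∀ {A} → γ A ∘ T.μ A ≈ S.μ A ∘ S.F₁ (γ A) ∘ γ (T.F₀ A)
    γ-μ = ≈-sym (begin
      S.μ _ ∘ S.F₁ (γ _) ∘ γ _                            ≈⟨ cancelˡ (γ∘β≈id _) ⟨
      γ _ ∘ β _ ∘ S.μ _ ∘ S.F₁ (γ _) ∘ γ _                ≈⟨ refl⟩∘⟨ pullˡ β-μ ⟩
      γ _ ∘ (T.μ _ ∘ T.F₁ (β _) ∘ β _) ∘ S.F₁ (γ _) ∘ γ _ ≈⟨ refl⟩∘⟨ pullʳ (pullʳ (extendʳ β-natural)) ⟩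
      γ _ ∘ T.μ _ ∘ T.F₁ (β _) ∘ T.F₁ (γ _) ∘ β _ ∘ γ _   ≈⟨ refl⟩∘⟨ refl⟩∘⟨ refl⟩∘⟨ elimʳ (β∘γ≈id _) ⟩
      γ _ ∘ T.μ _ ∘ T.F₁ (β _) ∘ T.F₁ (γ _)               ≈⟨ refl⟩∘⟨ elimʳ T-β∘γ≈id ⟩
      γ _ ∘ T.μ _                                         ∎)
      where
      T-β∘γ≈id : ∀ {A} → T.F₁ (β A) ∘ T.F₁ (γ A) ≈ id
      T-β∘γ≈id = ≈-trans (≈-sym T-monad.F-homomorphism) (≈-trans (T-monad.F-resp-≈ (β∘γ≈id _)) T-monad.F-identity)

    γ-st : ∀ {A B} → γ (A ⊗₀ B) ∘ T.st A B ≈ S.st A B ∘ (id ⊗₁ γ B)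
    γ-st = ≈-sym (begin
      S.st _ _ ∘ (id ⊗₁ γ _)                       ≈⟨ cancelˡ (γ∘β≈id _) ⟨
      γ _ ∘ β _ ∘ S.st _ _ ∘ (id ⊗₁ γ _)           ≈⟨ refl⟩∘⟨ pullˡ β-st ⟩
      γ _ ∘ (T.st _ _ ∘ (id ⊗₁ β _)) ∘ (id ⊗₁ γ _) ≈⟨ refl⟩∘⟨ pullʳ id⊗∘id⊗ ⟩
      γ _ ∘ T.st _ _ ∘ (id ⊗₁ (β _ ∘ γ _))         ≈⟨ refl⟩∘⟨ elimʳ (≈-trans (≈-refl ⟩⊗⟨ β∘γ≈id _) ⊗-identity) ⟩
      γ _ ∘ T.st _ _                               ∎)

module TensorMonad {o ℓ e} {𝒞 : MonoidalDaggerCategory o ℓ e} (M : FrobeniusMonoid 𝒞) where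
  open Properties 𝒞
  open FrobeniusMonoid M renaming (mult to m; unit to u)
  open IsFrobeniusMonoid isFrobeniusMonoid
  open MonadData (tensorMonad 𝒞 monoid)

  private
    variable
      A B : Obj

  μ-natural : {f : A ⇒ B} → μ B ∘ F₁ (F₁ f) ≈ F₁ f ∘ μ A
  μ-natural {f = f} = begin
    ((id ⊗₁ m) ∘ α⇒) ∘ ((f ⊗₁ id) ⊗₁ id) ≈⟨ pullʳ α-natural ⟩
    (id ⊗₁ m) ∘ (f ⊗₁ (id ⊗₁ id)) ∘ α⇒   ≈⟨ refl⟩∘⟨ (≈-refl ⟩⊗⟨ ⊗-identity) ⟩∘⟨refl ⟩
    (id ⊗₁ m) ∘ (f ⊗₁ id) ∘ α⇒           ≈⟨ extendʳ (≈-sym ⊗id-commute) ⟩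
    (f ⊗₁ id) ∘ (id ⊗₁ m) ∘ α⇒           ∎

  η-natural : {f : A ⇒ B} → η B ∘ f ≈ F₁ f ∘ η A
  η-natural {f = f} = begin
    ((id ⊗₁ u) ∘ ρ⇒ †) ∘ f       ≈⟨ pullʳ ρ†-natural ⟩
    (id ⊗₁ u) ∘ (f ⊗₁ id) ∘ ρ⇒ † ≈⟨ extendʳ (≈-sym ⊗id-commute) ⟩
    (f ⊗₁ id) ∘ (id ⊗₁ u) ∘ ρ⇒ † ∎

  μ-assoc : μ A ∘ F₁ (μ A) ≈ μ A ∘ μ (F₀ A)
  μ-assoc = begin
    ((id ⊗₁ m) ∘ α⇒) ∘ (((id ⊗₁ m) ∘ α⇒) ⊗₁ id)                  ≈⟨ pullʳ (refl⟩∘⟨ ≈-sym ⊗id∘⊗id) ⟩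
    (id ⊗₁ m) ∘ α⇒ ∘ ((id ⊗₁ m) ⊗₁ id) ∘ (α⇒ ⊗₁ id)              ≈⟨ refl⟩∘⟨ extendʳ α-natural ⟩
    (id ⊗₁ m) ∘ (id ⊗₁ (m ⊗₁ id)) ∘ α⇒ ∘ (α⇒ ⊗₁ id)              ≈⟨ pullˡ id⊗∘id⊗ ⟩
    (id ⊗₁ (m ∘ (m ⊗₁ id))) ∘ α⇒ ∘ (α⇒ ⊗₁ id)                    ≈⟨ (≈-refl ⟩⊗⟨ m-assoc) ⟩∘⟨refl ⟩
    (id ⊗₁ (m ∘ (id ⊗₁ m) ∘ α⇒)) ∘ α⇒ ∘ (α⇒ ⊗₁ id)               ≈⟨ pushˡ (≈-sym id⊗∘id⊗) ⟩
    (id ⊗₁ m) ∘ (id ⊗₁ ((id ⊗₁ m) ∘ α⇒)) ∘ α⇒ ∘ (α⇒ ⊗₁ id)       ≈⟨ refl⟩∘⟨ pushˡ (≈-sym id⊗∘id⊗) ⟩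
    (id ⊗₁ m) ∘ (id ⊗₁ (id ⊗₁ m)) ∘ (id ⊗₁ α⇒) ∘ α⇒ ∘ (α⇒ ⊗₁ id) ≈⟨ refl⟩∘⟨ refl⟩∘⟨ pentagon ⟩
    (id ⊗₁ m) ∘ (id ⊗₁ (id ⊗₁ m)) ∘ α⇒ ∘ α⇒                      ≈⟨ refl⟩∘⟨ extendʳ α-natural ⟨
    (id ⊗₁ m) ∘ α⇒ ∘ ((id ⊗₁ id) ⊗₁ m) ∘ α⇒                      ≈⟨ refl⟩∘⟨ refl⟩∘⟨ (⊗-identity ⟩⊗⟨ ≈-refl) ⟩∘⟨refl ⟩
    (id ⊗₁ m) ∘ α⇒ ∘ (id ⊗₁ m) ∘ α⇒                              ≈⟨ sym-assoc ⟩
    ((id ⊗₁ m) ∘ α⇒) ∘ ((id ⊗₁ m) ∘ α⇒)                          ∎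

  μ-unitˡ : μ A ∘ F₁ (η A) ≈ id
  μ-unitˡ = begin
    ((id ⊗₁ m) ∘ α⇒) ∘ (((id ⊗₁ u) ∘ ρ⇒ †) ⊗₁ id)     ≈⟨ pullʳ (refl⟩∘⟨ ≈-sym ⊗id∘⊗id) ⟩
    (id ⊗₁ m) ∘ α⇒ ∘ ((id ⊗₁ u) ⊗₁ id) ∘ (ρ⇒ † ⊗₁ id) ≈⟨ refl⟩∘⟨ extendʳ α-natural ⟩
    (id ⊗₁ m) ∘ (id ⊗₁ (u ⊗₁ id)) ∘ α⇒ ∘ (ρ⇒ † ⊗₁ id) ≈⟨ refl⟩∘⟨ refl⟩∘⟨ triangle-inv ⟩
    (id ⊗₁ m) ∘ (id ⊗₁ (u ⊗₁ id)) ∘ (id ⊗₁ λ⇒ †)      ≈⟨ ≈-trans (refl⟩∘⟨ id⊗∘id⊗) id⊗∘id⊗ ⟩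
    id ⊗₁ (m ∘ (u ⊗₁ id) ∘ λ⇒ †)                      ≈⟨ ≈-refl ⟩⊗⟨ pullˡ m-unitˡ ⟩
    id ⊗₁ (λ⇒ ∘ λ⇒ †)                                 ≈⟨ ≈-refl ⟩⊗⟨ λ-unitaryʳ ⟩
    id ⊗₁ id                                          ≈⟨ ⊗-identity ⟩
    id                                                ∎

  μ-unitʳ : μ A ∘ η (F₀ A) ≈ id
  μ-unitʳ = begin
    ((id ⊗₁ m) ∘ α⇒) ∘ ((id ⊗₁ u) ∘ ρ⇒ †)        ≈⟨ assoc ⟩
    (id ⊗₁ m) ∘ α⇒ ∘ (id ⊗₁ u) ∘ ρ⇒ †            ≈⟨ refl⟩∘⟨ refl⟩∘⟨ (⊗-identity ⟩⊗⟨ ≈-refl) ⟩∘⟨refl ⟨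
    (id ⊗₁ m) ∘ α⇒ ∘ ((id ⊗₁ id) ⊗₁ u) ∘ ρ⇒ †    ≈⟨ refl⟩∘⟨ extendʳ α-natural ⟩
    (id ⊗₁ m) ∘ (id ⊗₁ (id ⊗₁ u)) ∘ α⇒ ∘ ρ⇒ †    ≈⟨ refl⟩∘⟨ refl⟩∘⟨ coherence₂-inv ⟩
    (id ⊗₁ m) ∘ (id ⊗₁ (id ⊗₁ u)) ∘ (id ⊗₁ ρ⇒ †) ≈⟨ ≈-trans (refl⟩∘⟨ id⊗∘id⊗) id⊗∘id⊗ ⟩
    id ⊗₁ (m ∘ (id ⊗₁ u) ∘ ρ⇒ †)                 ≈⟨ ≈-refl ⟩⊗⟨ pullˡ m-unitʳ ⟩
    id ⊗₁ (ρ⇒ ∘ ρ⇒ †)                            ≈⟨ ≈-refl ⟩⊗⟨ ρ-unitaryʳ ⟩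
    id ⊗₁ id                                     ≈⟨ ⊗-identity ⟩
    id                                           ∎

  μ-frobenius : F₁ (μ A) ∘ μ (F₀ A) † ≈ μ (F₀ A) ∘ F₁ (μ A †)
  μ-frobenius = begin
    (((id ⊗₁ m) ∘ α⇒) ⊗₁ id) ∘ ((id ⊗₁ m) ∘ α⇒) †
      ≈⟨ ≈-sym ⊗id∘⊗id ⟩∘⟨ †-homomorphism ⟩
    (((id ⊗₁ m) ⊗₁ id) ∘ (α⇒ ⊗₁ id)) ∘ (α⇒ † ∘ (id ⊗₁ m) †)
      ≈⟨ pullʳ (pullˡ pentagon-invˡ) ⟩
    ((id ⊗₁ m) ⊗₁ id) ∘ (α⇒ † ∘ (id ⊗₁ α⇒ †) ∘ α⇒) ∘ (id ⊗₁ m) †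
      ≈⟨ refl⟩∘⟨ pullʳ assoc ⟩
    ((id ⊗₁ m) ⊗₁ id) ∘ α⇒ † ∘ (id ⊗₁ α⇒ †) ∘ α⇒ ∘ (id ⊗₁ m) †
      ≈⟨ extendʳ α†-natural ⟨
    α⇒ † ∘ (id ⊗₁ (m ⊗₁ id)) ∘ (id ⊗₁ α⇒ †) ∘ α⇒ ∘ (id ⊗₁ m) †
      ≈⟨ refl⟩∘⟨ refl⟩∘⟨ refl⟩∘⟨ refl⟩∘⟨ ≈-trans id⊗-† (≈-sym ⊗-identity ⟩⊗⟨ ≈-refl) ⟩
    α⇒ † ∘ (id ⊗₁ (m ⊗₁ id)) ∘ (id ⊗₁ α⇒ †) ∘ α⇒ ∘ ((id ⊗₁ id) ⊗₁ m †)
      ≈⟨ refl⟩∘⟨ refl⟩∘⟨ refl⟩∘⟨ α-natural ⟩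
    α⇒ † ∘ (id ⊗₁ (m ⊗₁ id)) ∘ (id ⊗₁ α⇒ †) ∘ (id ⊗₁ (id ⊗₁ m †)) ∘ α⇒
      ≈⟨ refl⟩∘⟨ ≈-trans (refl⟩∘⟨ pullˡ id⊗∘id⊗) (pullˡ id⊗∘id⊗) ⟩
    α⇒ † ∘ (id ⊗₁ ((m ⊗₁ id) ∘ α⇒ † ∘ (id ⊗₁ m †))) ∘ α⇒
      ≈⟨ refl⟩∘⟨ (≈-refl ⟩⊗⟨ frobenius) ⟩∘⟨refl ⟨
    α⇒ † ∘ (id ⊗₁ ((id ⊗₁ m) ∘ α⇒ ∘ (m † ⊗₁ id))) ∘ α⇒
      ≈⟨ refl⟩∘⟨ ≈-trans (pushˡ (≈-sym id⊗∘id⊗)) (refl⟩∘⟨ pushˡ (≈-sym id⊗∘id⊗)) ⟩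
    α⇒ † ∘ (id ⊗₁ (id ⊗₁ m)) ∘ (id ⊗₁ α⇒) ∘ (id ⊗₁ (m † ⊗₁ id)) ∘ α⇒
      ≈⟨ refl⟩∘⟨ refl⟩∘⟨ refl⟩∘⟨ α-natural ⟨
    α⇒ † ∘ (id ⊗₁ (id ⊗₁ m)) ∘ (id ⊗₁ α⇒) ∘ α⇒ ∘ ((id ⊗₁ m †) ⊗₁ id)
      ≈⟨ extendʳ α†-natural ⟩
    ((id ⊗₁ id) ⊗₁ m) ∘ α⇒ † ∘ (id ⊗₁ α⇒) ∘ α⇒ ∘ ((id ⊗₁ m †) ⊗₁ id)
      ≈⟨ (⊗-identity ⟩⊗⟨ ≈-refl) ⟩∘⟨ ≈-trans (refl⟩∘⟨ sym-assoc) sym-assoc ⟩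
    (id ⊗₁ m) ∘ (α⇒ † ∘ (id ⊗₁ α⇒) ∘ α⇒) ∘ ((id ⊗₁ m †) ⊗₁ id)
      ≈⟨ refl⟩∘⟨ pullˡ pentagon-invʳ ⟨
    (id ⊗₁ m) ∘ α⇒ ∘ (α⇒ † ⊗₁ id) ∘ ((id ⊗₁ m †) ⊗₁ id)
      ≈⟨ refl⟩∘⟨ refl⟩∘⟨ ⊗id∘⊗id ⟩
    (id ⊗₁ m) ∘ α⇒ ∘ ((α⇒ † ∘ (id ⊗₁ m †)) ⊗₁ id)
      ≈⟨ refl⟩∘⟨ refl⟩∘⟨ (≈-trans †-homomorphism (refl⟩∘⟨ id⊗-†) ⟩⊗⟨ ≈-refl) ⟨
    (id ⊗₁ m) ∘ α⇒ ∘ (((id ⊗₁ m) ∘ α⇒) † ⊗₁ id)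
      ≈⟨ sym-assoc ⟩
    ((id ⊗₁ m) ∘ α⇒) ∘ (((id ⊗₁ m) ∘ α⇒) † ⊗₁ id) ∎

  st-μ : st A B ∘ (id ⊗₁ μ B) ≈ μ (A ⊗₀ B) ∘ F₁ (st A B) ∘ st A (F₀ B)
  st-μ = ≈-sym (begin
    ((id ⊗₁ m) ∘ α⇒) ∘ ((α⇒ † ⊗₁ id) ∘ α⇒ †)    ≈⟨ pullʳ (pullˡ pentagon-invʳ) ⟩
    (id ⊗₁ m) ∘ (α⇒ † ∘ (id ⊗₁ α⇒) ∘ α⇒) ∘ α⇒ † ≈⟨ refl⟩∘⟨ pullʳ (pullʳ α-unitaryʳ) ⟩
    (id ⊗₁ m) ∘ α⇒ † ∘ (id ⊗₁ α⇒) ∘ id          ≈⟨ refl⟩∘⟨ refl⟩∘⟨ identityʳ ⟩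
    (id ⊗₁ m) ∘ α⇒ † ∘ (id ⊗₁ α⇒)               ≈⟨ (⊗-identity ⟩⊗⟨ ≈-refl) ⟩∘⟨refl ⟨
    ((id ⊗₁ id) ⊗₁ m) ∘ α⇒ † ∘ (id ⊗₁ α⇒)       ≈⟨ extendʳ α†-natural ⟨
    α⇒ † ∘ (id ⊗₁ (id ⊗₁ m)) ∘ (id ⊗₁ α⇒)       ≈⟨ refl⟩∘⟨ id⊗∘id⊗ ⟩
    α⇒ † ∘ (id ⊗₁ ((id ⊗₁ m) ∘ α⇒))             ∎)

  st-η : st A B ∘ (id ⊗₁ η B) ≈ η (A ⊗₀ B)
  st-η = begin
    α⇒ † ∘ (id ⊗₁ ((id ⊗₁ u) ∘ ρ⇒ †))       ≈⟨ refl⟩∘⟨ id⊗∘id⊗ ⟨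
    α⇒ † ∘ (id ⊗₁ (id ⊗₁ u)) ∘ (id ⊗₁ ρ⇒ †) ≈⟨ extendʳ α†-natural ⟩
    ((id ⊗₁ id) ⊗₁ u) ∘ α⇒ † ∘ (id ⊗₁ ρ⇒ †) ≈⟨ (⊗-identity ⟩⊗⟨ ≈-refl) ⟩∘⟨ coherence₂-inv′ ⟩
    (id ⊗₁ u) ∘ ρ⇒ †                        ∎

  isStrongFrobeniusMonad : IsStrongFrobeniusMonad 𝒞 (tensorMonad 𝒞 monoid)
  isStrongFrobeniusMonad = record
    { F-identity     = ⊗-identity
    ; F-homomorphism = ≈-sym ⊗id∘⊗id
    ; F-resp-≈       = _⟩⊗⟨ ≈-refl
    ; μ-natural      = μ-natural
    ; η-natural      = η-natural
    ; μ-assoc        = μ-assoc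
    ; μ-unitˡ        = μ-unitˡ
    ; μ-unitʳ        = μ-unitʳ
    ; F-†            = ≈-sym ⊗id-†
    ; frobenius      = μ-frobenius
    ; st-natural     = α†-natural
    ; st-α           = pentagon-invˡ
    ; st-λ           = coherence₁-inv
    ; st-μ           = st-μ
    ; st-η           = st-η
    ; st-unitaryˡ    = unitaryˡ (†-unitary α-unitary)
    ; st-unitaryʳ    = unitaryʳ (†-unitary α-unitary)
    }

module _ {o ℓ e} {𝒞 : MonoidalDaggerCategory o ℓ e} where
  open Properties 𝒞

  tensorMor-isStrongMonadMorphism : {M N : FrobeniusMonoid 𝒞} (f : MonoidHom 𝒞 M N)
    → IsStrongMonadMorphism 𝒞 (tensorMonad 𝒞 (FrobeniusMonoid.monoid M)) (tensorMonad 𝒞 (FrobeniusMonoid.monoid N))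
                              (tensorMor 𝒞 (FrobeniusMonoid.monoid M) (FrobeniusMonoid.monoid N) (MonoidHom.hom f))
  tensorMor-isStrongMonadMorphism {M} {N} f = record
    { β-natural = ≈-sym ⊗id-commute
    ; β-η       = ≈-trans (pullˡ id⊗∘id⊗) ((≈-refl ⟩⊗⟨ pres-unit) ⟩∘⟨refl)
    ; β-μ       = ≈-sym (begin
        ((id ⊗₁ N.mult) ∘ α⇒) ∘ ((id ⊗₁ h) ⊗₁ id) ∘ (id ⊗₁ h) ≈⟨ pullʳ (refl⟩∘⟨ ≈-trans ⊗∘⊗ (identityʳ ⟩⊗⟨ identityˡ)) ⟩
        (id ⊗₁ N.mult) ∘ α⇒ ∘ ((id ⊗₁ h) ⊗₁ h)                ≈⟨ refl⟩∘⟨ α-natural ⟩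
        (id ⊗₁ N.mult) ∘ (id ⊗₁ (h ⊗₁ h)) ∘ α⇒                ≈⟨ pullˡ id⊗∘id⊗ ⟩
        (id ⊗₁ (N.mult ∘ (h ⊗₁ h))) ∘ α⇒                      ≈⟨ (≈-refl ⟩⊗⟨ pres-mult) ⟩∘⟨refl ⟨
        (id ⊗₁ (h ∘ M.mult)) ∘ α⇒                             ≈⟨ pushˡ (≈-sym id⊗∘id⊗) ⟩
        (id ⊗₁ h) ∘ (id ⊗₁ M.mult) ∘ α⇒                       ∎)
    ; β-st      = ≈-sym (≈-trans α†-natural ((⊗-identity ⟩⊗⟨ ≈-refl) ⟩∘⟨refl))
    }
    where
    module M = FrobeniusMonoid M
    module N = FrobeniusMonoid N
    h = MonoidHom.hom f
    open IsMonoidHom (MonoidHom.isHom f)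

  λ-isMonoidHom : (M : FrobeniusMonoid 𝒞)
    → IsMonoidHom 𝒞 (monadAtUnit 𝒞 (tensorMonad 𝒞 (FrobeniusMonoid.monoid M))) (FrobeniusMonoid.monoid M) λ⇒
  λ-isMonoidHom M = record
    { pres-mult = begin
        λ⇒ ∘ ((id ⊗₁ mult) ∘ α⇒) ∘ (ρ⇒ ⊗₁ id) ∘ α⇒ †   ≈⟨ pullˡ (pullˡ λ-natural) ⟩
        ((mult ∘ λ⇒) ∘ α⇒) ∘ (ρ⇒ ⊗₁ id) ∘ α⇒ †         ≈⟨ pullʳ coherence₁ ⟩∘⟨refl ⟩
        (mult ∘ (λ⇒ ⊗₁ id)) ∘ (ρ⇒ ⊗₁ id) ∘ α⇒ †        ≈⟨ refl⟩∘⟨ triangle ⟩∘⟨refl ⟨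
        (mult ∘ (λ⇒ ⊗₁ id)) ∘ ((id ⊗₁ λ⇒) ∘ α⇒) ∘ α⇒ † ≈⟨ refl⟩∘⟨ cancelʳ α-unitaryʳ ⟩
        (mult ∘ (λ⇒ ⊗₁ id)) ∘ (id ⊗₁ λ⇒)               ≈⟨ pullʳ (≈-sym serialize₁₂) ⟩
        mult ∘ (λ⇒ ⊗₁ λ⇒)                              ∎
    ; pres-unit = begin
        λ⇒ ∘ (id ⊗₁ unit) ∘ ρ⇒ † ≈⟨ pullˡ λ-natural ⟩
        (unit ∘ λ⇒) ∘ ρ⇒ †       ≈⟨ (refl⟩∘⟨ coherence₃) ⟩∘⟨refl ⟩
        (unit ∘ ρ⇒) ∘ ρ⇒ †       ≈⟨ cancelʳ ρ-unitaryʳ ⟩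
        unit                     ∎
    }
    where open FrobeniusMonoid M

module MonadAtUnit {o ℓ e} {𝒞 : MonoidalDaggerCategory o ℓ e} (T : StrongFrobeniusMonad 𝒞) where
  open Properties 𝒞
  open StrongFrobeniusMonad T
  open IsStrongFrobeniusMonad isStrongFrobeniusMonad renaming (frobenius to μ-frobenius)
  open MonoidData (monadAtUnit 𝒞 monad) using (mult)

  private
    variable
      A B C : Obj

  F₁-∘ : {f : A ⇒ B} {g : B ⇒ C} → F₁ g ∘ F₁ f ≈ F₁ (g ∘ f)
  F₁-∘ = ≈-sym F-homomorphism

  F₁-unitary : {u : A ⇒ B} → Unitary u → Unitary (F₁ u)
  F₁-unitary U = record
    { unitaryˡ = ≈-trans (≈-sym F-† ⟩∘⟨refl) (≈-trans F₁-∘ (≈-trans (F-resp-≈ (unitaryˡ U)) F-identity))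
    ; unitaryʳ = ≈-trans (refl⟩∘⟨ ≈-sym F-†) (≈-trans F₁-∘ (≈-trans (F-resp-≈ (unitaryʳ U)) F-identity))
    }

  st-natural₁ : {f : A ⇒ B} → st B C ∘ (f ⊗₁ id) ≈ F₁ (f ⊗₁ id) ∘ st A C
  st-natural₁ = ≈-trans (refl⟩∘⟨ (≈-refl ⟩⊗⟨ ≈-sym F-identity)) st-natural

  φ : ∀ A → A ⊗₀ F₀ I ⇒ F₀ A
  φ A = F₁ ρ⇒ ∘ st A I

  φ-unitary : Unitary (φ A)
  φ-unitary = ∘-unitary (F₁-unitary ρ-unitary) (record { unitaryˡ = st-unitaryˡ ; unitaryʳ = st-unitaryʳ })

  φ-natural : {f : A ⇒ B} → φ B ∘ (f ⊗₁ id) ≈ F₁ f ∘ φ A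
  φ-natural {f = f} = begin
    (F₁ ρ⇒ ∘ st _ I) ∘ (f ⊗₁ id)  ≈⟨ pullʳ st-natural₁ ⟩
    F₁ ρ⇒ ∘ F₁ (f ⊗₁ id) ∘ st _ I ≈⟨ pullˡ F₁-∘ ⟩
    F₁ (ρ⇒ ∘ (f ⊗₁ id)) ∘ st _ I  ≈⟨ F-resp-≈ ρ-natural ⟩∘⟨refl ⟩
    F₁ (f ∘ ρ⇒) ∘ st _ I          ≈⟨ pushˡ F-homomorphism ⟩
    F₁ f ∘ F₁ ρ⇒ ∘ st _ I         ∎

  φ-η : φ A ∘ (id ⊗₁ η I) ∘ ρ⇒ † ≈ η A
  φ-η = begin
    (F₁ ρ⇒ ∘ st _ I) ∘ (id ⊗₁ η I) ∘ ρ⇒ † ≈⟨ pullʳ (pullˡ st-η) ⟩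
    F₁ ρ⇒ ∘ η _ ∘ ρ⇒ †                    ≈⟨ pullˡ (≈-sym η-natural) ⟩
    (η _ ∘ ρ⇒) ∘ ρ⇒ †                     ≈⟨ cancelʳ ρ-unitaryʳ ⟩
    η _                                   ∎

  φ-μ : φ A ∘ (id ⊗₁ mult) ∘ α⇒ ≈ μ A ∘ F₁ (φ A) ∘ φ (A ⊗₀ F₀ I)
  φ-μ = begin
    (F₁ ρ⇒ ∘ st _ I) ∘ (id ⊗₁ (μ I ∘ F₁ ρ⇒ ∘ st _ I)) ∘ α⇒
      ≈⟨ pullʳ (refl⟩∘⟨ pushˡ (≈-sym id⊗∘id⊗)) ⟩
    F₁ ρ⇒ ∘ st _ I ∘ (id ⊗₁ μ I) ∘ (id ⊗₁ (F₁ ρ⇒ ∘ st _ I)) ∘ α⇒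
      ≈⟨ refl⟩∘⟨ pullˡ st-μ ⟩
    F₁ ρ⇒ ∘ (μ _ ∘ F₁ (st _ I) ∘ st _ _) ∘ (id ⊗₁ (F₁ ρ⇒ ∘ st _ I)) ∘ α⇒
      ≈⟨ refl⟩∘⟨ pullʳ (pullʳ (refl⟩∘⟨ pushˡ (≈-sym id⊗∘id⊗))) ⟩
    F₁ ρ⇒ ∘ μ _ ∘ F₁ (st _ I) ∘ st _ _ ∘ (id ⊗₁ F₁ ρ⇒) ∘ (id ⊗₁ st _ I) ∘ α⇒
      ≈⟨ refl⟩∘⟨ refl⟩∘⟨ refl⟩∘⟨ extendʳ st-natural ⟩
    F₁ ρ⇒ ∘ μ _ ∘ F₁ (st _ I) ∘ F₁ (id ⊗₁ ρ⇒) ∘ st _ _ ∘ (id ⊗₁ st _ I) ∘ α⇒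
      ≈⟨ refl⟩∘⟨ refl⟩∘⟨ refl⟩∘⟨ refl⟩∘⟨ st-α ⟨
    F₁ ρ⇒ ∘ μ _ ∘ F₁ (st _ I) ∘ F₁ (id ⊗₁ ρ⇒) ∘ F₁ α⇒ ∘ st _ I
      ≈⟨ refl⟩∘⟨ refl⟩∘⟨ refl⟩∘⟨ pullˡ F₁-∘ ⟩
    F₁ ρ⇒ ∘ μ _ ∘ F₁ (st _ I) ∘ F₁ ((id ⊗₁ ρ⇒) ∘ α⇒) ∘ st _ I
      ≈⟨ refl⟩∘⟨ refl⟩∘⟨ refl⟩∘⟨ F-resp-≈ coherence₂ ⟩∘⟨refl ⟩
    F₁ ρ⇒ ∘ μ _ ∘ F₁ (st _ I) ∘ F₁ ρ⇒ ∘ st _ I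
      ≈⟨ extendʳ μ-natural ⟨
    μ _ ∘ F₁ (F₁ ρ⇒) ∘ F₁ (st _ I) ∘ F₁ ρ⇒ ∘ st _ I
      ≈⟨ refl⟩∘⟨ pullˡ F₁-∘ ⟩
    μ _ ∘ F₁ (F₁ ρ⇒ ∘ st _ I) ∘ F₁ ρ⇒ ∘ st _ I ∎

  φ-st : φ (A ⊗₀ B) ∘ α⇒ † ≈ st A B ∘ (id ⊗₁ φ B)
  φ-st = ≈-sym (begin
    st _ _ ∘ (id ⊗₁ (F₁ ρ⇒ ∘ st _ I))       ≈⟨ refl⟩∘⟨ id⊗∘id⊗ ⟨
    st _ _ ∘ (id ⊗₁ F₁ ρ⇒) ∘ (id ⊗₁ st _ I) ≈⟨ extendʳ st-natural ⟩
    F₁ (id ⊗₁ ρ⇒) ∘ st _ _ ∘ (id ⊗₁ st _ I) ≈⟨ refl⟩∘⟨ unitary-moveʳ α-unitary (≈-trans assoc (≈-sym st-α)) ⟩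
    F₁ (id ⊗₁ ρ⇒) ∘ (F₁ α⇒ ∘ st _ I) ∘ α⇒ † ≈⟨ refl⟩∘⟨ assoc ⟩
    F₁ (id ⊗₁ ρ⇒) ∘ F₁ α⇒ ∘ st _ I ∘ α⇒ †   ≈⟨ pullˡ F₁-∘ ⟩
    F₁ ((id ⊗₁ ρ⇒) ∘ α⇒) ∘ st _ I ∘ α⇒ †    ≈⟨ F-resp-≈ coherence₂ ⟩∘⟨refl ⟩
    F₁ ρ⇒ ∘ st _ I ∘ α⇒ †                   ≈⟨ sym-assoc ⟩
    (F₁ ρ⇒ ∘ st _ I) ∘ α⇒ †                 ∎)

  -- mult is definitionally μ I ∘ φ (F₀ I).
  m-assoc : mult ∘ (mult ⊗₁ id) ≈ mult ∘ (id ⊗₁ mult) ∘ α⇒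
  m-assoc = begin
    (μ I ∘ φ _) ∘ (mult ⊗₁ id)      ≈⟨ pullʳ φ-natural ⟩
    μ I ∘ F₁ (μ I ∘ φ _) ∘ φ _      ≈⟨ refl⟩∘⟨ pushˡ F-homomorphism ⟩
    μ I ∘ F₁ (μ I) ∘ F₁ (φ _) ∘ φ _ ≈⟨ pullˡ μ-assoc ⟩
    (μ I ∘ μ _) ∘ F₁ (φ _) ∘ φ _    ≈⟨ assoc ⟩
    μ I ∘ μ _ ∘ F₁ (φ _) ∘ φ _      ≈⟨ refl⟩∘⟨ φ-μ ⟨
    μ I ∘ φ _ ∘ (id ⊗₁ mult) ∘ α⇒   ≈⟨ sym-assoc ⟩
    (μ I ∘ φ _) ∘ (id ⊗₁ mult) ∘ α⇒ ∎

  m-unitˡ : mult ∘ (η I ⊗₁ id) ≈ λ⇒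
  m-unitˡ = begin
    (μ I ∘ F₁ ρ⇒ ∘ st _ I) ∘ (η I ⊗₁ id)  ≈⟨ pullʳ (pullʳ st-natural₁) ⟩
    μ I ∘ F₁ ρ⇒ ∘ F₁ (η I ⊗₁ id) ∘ st I I ≈⟨ refl⟩∘⟨ pullˡ F₁-∘ ⟩
    μ I ∘ F₁ (ρ⇒ ∘ (η I ⊗₁ id)) ∘ st I I  ≈⟨ refl⟩∘⟨ F-resp-≈ ρ-natural ⟩∘⟨refl ⟩
    μ I ∘ F₁ (η I ∘ ρ⇒) ∘ st I I          ≈⟨ refl⟩∘⟨ pushˡ F-homomorphism ⟩
    μ I ∘ F₁ (η I) ∘ F₁ ρ⇒ ∘ st I I       ≈⟨ cancelˡ μ-unitˡ ⟩
    F₁ ρ⇒ ∘ st I I                        ≈⟨ F-resp-≈ coherence₃ ⟩∘⟨refl ⟨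
    F₁ λ⇒ ∘ st I I                        ≈⟨ st-λ ⟩
    λ⇒                                    ∎

  m-unitʳ : mult ∘ (id ⊗₁ η I) ≈ ρ⇒
  m-unitʳ = begin
    (μ I ∘ F₁ ρ⇒ ∘ st _ I) ∘ (id ⊗₁ η I) ≈⟨ pullʳ (pullʳ st-η) ⟩
    μ I ∘ F₁ ρ⇒ ∘ η _                    ≈⟨ refl⟩∘⟨ η-natural ⟨
    μ I ∘ η _ ∘ ρ⇒                       ≈⟨ cancelˡ μ-unitʳ ⟩
    ρ⇒                                   ∎

  m-frobenius : (id ⊗₁ mult) ∘ α⇒ ∘ (mult † ⊗₁ id) ≈ (mult ⊗₁ id) ∘ α⇒ † ∘ (id ⊗₁ mult †)
  m-frobenius = unitary-cancelˡ φ-unitary (begin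
    φ _ ∘ (id ⊗₁ mult) ∘ α⇒ ∘ (mult † ⊗₁ id)
      ≈⟨ refl⟩∘⟨ sym-assoc ⟩
    φ _ ∘ ((id ⊗₁ mult) ∘ α⇒) ∘ (mult † ⊗₁ id)
      ≈⟨ pullˡ φ-μ ⟩
    (μ _ ∘ F₁ (φ _) ∘ φ _) ∘ (mult † ⊗₁ id)
      ≈⟨ pullʳ (pullʳ φ-natural) ⟩
    μ _ ∘ F₁ (φ _) ∘ F₁ (mult †) ∘ φ _
      ≈⟨ refl⟩∘⟨ pullˡ (≈-trans F₁-∘ (F-resp-≈ φ∘mult†)) ⟩
    μ _ ∘ F₁ (μ I †) ∘ φ _
      ≈⟨ pullˡ (≈-sym μ-frobenius) ⟩
    (F₁ (μ I) ∘ μ _ †) ∘ φ _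
      ≈⟨ (F-resp-≈ (cancelʳ (unitaryʳ φ-unitary)) ⟩∘⟨refl) ⟩∘⟨refl ⟨
    (F₁ (mult ∘ φ _ †) ∘ μ _ †) ∘ φ _
      ≈⟨ pushˡ F-homomorphism ⟩∘⟨refl ⟩
    (F₁ mult ∘ F₁ (φ _ †) ∘ μ _ †) ∘ φ _
      ≈⟨ (refl⟩∘⟨ ≈-trans (F-† ⟩∘⟨refl) (≈-sym †-homomorphism)) ⟩∘⟨refl ⟩
    (F₁ mult ∘ (μ _ ∘ F₁ (φ _)) †) ∘ φ _
      ≈⟨ assoc ⟩
    F₁ mult ∘ (μ _ ∘ F₁ (φ _)) † ∘ φ _
      ≈⟨ refl⟩∘⟨ unitary-square-† φ-unitary φ-unitary (≈-trans φ-μ sym-assoc) ⟨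
    F₁ mult ∘ φ _ ∘ ((id ⊗₁ mult) ∘ α⇒) †
      ≈⟨ refl⟩∘⟨ refl⟩∘⟨ ≈-trans †-homomorphism (refl⟩∘⟨ id⊗-†) ⟩
    F₁ mult ∘ φ _ ∘ α⇒ † ∘ (id ⊗₁ mult †)
      ≈⟨ extendʳ φ-natural ⟨
    φ _ ∘ (mult ⊗₁ id) ∘ α⇒ † ∘ (id ⊗₁ mult †) ∎)
    where
    φ∘mult† : φ (F₀ I) ∘ mult † ≈ μ I †
    φ∘mult† = begin
      φ _ ∘ (μ I ∘ φ _) †   ≈⟨ refl⟩∘⟨ †-homomorphism ⟩
      φ _ ∘ (φ _ † ∘ μ I †) ≈⟨ cancelˡ (unitaryʳ φ-unitary) ⟩
      μ I †                 ∎

  isFrobeniusMonoid : IsFrobeniusMonoid 𝒞 (monadAtUnit 𝒞 monad)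
  isFrobeniusMonoid = record
    { m-assoc = m-assoc ; m-unitˡ = m-unitˡ ; m-unitʳ = m-unitʳ ; frobenius = m-frobenius }

  φ-isStrongMonadMorphism : IsStrongMonadMorphism 𝒞 (tensorMonad 𝒞 (monadAtUnit 𝒞 monad)) monad φ
  φ-isStrongMonadMorphism = record { β-natural = φ-natural ; β-η = φ-η ; β-μ = φ-μ ; β-st = φ-st }

  φ†-isStrongMonadMorphism : IsStrongMonadMorphism 𝒞 monad (tensorMonad 𝒞 (monadAtUnit 𝒞 monad)) (λ A → φ A †)
  φ†-isStrongMonadMorphism =
    inverse-isStrongMonadMorphism isStrongFrobeniusMonad (λ _ → unitaryˡ φ-unitary) (λ _ → unitaryʳ φ-unitary)
      φ-isStrongMonadMorphism

module _ {o ℓ e} {𝒞 : MonoidalDaggerCategory o ℓ e} {T S : StrongFrobeniusMonad 𝒞}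
         (β : StrongMonadMorphism 𝒞 T S) where
  open Properties 𝒞
  private
    module T = StrongFrobeniusMonad T
    module S = StrongFrobeniusMonad S
    module S-monad = IsStrongFrobeniusMonad S.isStrongFrobeniusMonad
    open StrongMonadMorphism β renaming (β to β₀)
    open IsStrongMonadMorphism isMorphism

  atUnit-isMonoidHom : IsMonoidHom 𝒞 (monadAtUnit 𝒞 T.monad) (monadAtUnit 𝒞 S.monad) (atUnit 𝒞 T.monad S.monad β₀)
  atUnit-isMonoidHom = record { pres-mult = pres-mult ; pres-unit = β-η }
    where
    pres-mult : β₀ I ∘ T.μ I ∘ T.F₁ ρ⇒ ∘ T.st _ I ≈ (S.μ I ∘ S.F₁ ρ⇒ ∘ S.st _ I) ∘ (β₀ I ⊗₁ β₀ I)
    pres-mult = begin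
      β₀ I ∘ T.μ I ∘ T.F₁ ρ⇒ ∘ T.st _ I                             ≈⟨ pullˡ β-μ ⟩
      (S.μ I ∘ S.F₁ (β₀ I) ∘ β₀ _) ∘ T.F₁ ρ⇒ ∘ T.st _ I             ≈⟨ pullʳ (pullʳ (extendʳ β-natural)) ⟩
      S.μ I ∘ S.F₁ (β₀ I) ∘ S.F₁ ρ⇒ ∘ β₀ _ ∘ T.st _ I               ≈⟨ refl⟩∘⟨ refl⟩∘⟨ refl⟩∘⟨ β-st ⟩
      S.μ I ∘ S.F₁ (β₀ I) ∘ S.F₁ ρ⇒ ∘ S.st _ I ∘ (id ⊗₁ β₀ I)       ≈⟨ refl⟩∘⟨ pullˡ (≈-sym S-monad.F-homomorphism) ⟩
      S.μ I ∘ S.F₁ (β₀ I ∘ ρ⇒) ∘ S.st _ I ∘ (id ⊗₁ β₀ I)            ≈⟨ refl⟩∘⟨ S-monad.F-resp-≈ ρ-natural ⟩∘⟨refl ⟨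
      S.μ I ∘ S.F₁ (ρ⇒ ∘ (β₀ I ⊗₁ id)) ∘ S.st _ I ∘ (id ⊗₁ β₀ I)    ≈⟨ refl⟩∘⟨ pushˡ S-monad.F-homomorphism ⟩
      S.μ I ∘ S.F₁ ρ⇒ ∘ S.F₁ (β₀ I ⊗₁ id) ∘ S.st _ I ∘ (id ⊗₁ β₀ I) ≈⟨ refl⟩∘⟨ refl⟩∘⟨ extendʳ st-natural₁ ⟨
      S.μ I ∘ S.F₁ ρ⇒ ∘ S.st _ I ∘ (β₀ I ⊗₁ id) ∘ (id ⊗₁ β₀ I)      ≈⟨ refl⟩∘⟨ refl⟩∘⟨ refl⟩∘⟨ serialize₁₂ ⟨
      S.μ I ∘ S.F₁ ρ⇒ ∘ S.st _ I ∘ (β₀ I ⊗₁ β₀ I)                   ≈⟨ refl⟩∘⟨ sym-assoc ⟩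
      S.μ I ∘ (S.F₁ ρ⇒ ∘ S.st _ I) ∘ (β₀ I ⊗₁ β₀ I)                 ≈⟨ sym-assoc ⟩
      (S.μ I ∘ S.F₁ ρ⇒ ∘ S.st _ I) ∘ (β₀ I ⊗₁ β₀ I)                 ∎
      where open MonadAtUnit S using (st-natural₁)

  φ†-natural : ∀ A → MonadAtUnit.φ S A † ∘ β₀ A ≈ (id ⊗₁ β₀ I) ∘ MonadAtUnit.φ T A †
  φ†-natural A = unitary-transpose (MonadAtUnit.φ-unitary S) (MonadAtUnit.φ-unitary T) (≈-sym (begin
    β₀ A ∘ T.F₁ ρ⇒ ∘ T.st A I           ≈⟨ extendʳ β-natural ⟩
    S.F₁ ρ⇒ ∘ β₀ _ ∘ T.st A I           ≈⟨ refl⟩∘⟨ β-st ⟩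
    S.F₁ ρ⇒ ∘ S.st A I ∘ (id ⊗₁ β₀ I)   ≈⟨ sym-assoc ⟩
    (S.F₁ ρ⇒ ∘ S.st A I) ∘ (id ⊗₁ β₀ I) ∎))

theorem4p9 : ∀ {o ℓ e} (𝒞 : MonoidalDaggerCategory o ℓ e) → AssignmentsDefineEquivalence 𝒞
theorem4p9 𝒞 = record
  { F-obj             = TensorMonad.isStrongFrobeniusMonad
  ; G-obj             = MonadAtUnit.isFrobeniusMonoid
  ; F-mor             = tensorMor-isStrongMonadMorphism
  ; G-mor             = atUnit-isMonoidHom
  ; F-identity        = λ _ → ⊗-identity
  ; F-homomorphism    = λ _ _ _ → ≈-sym id⊗∘id⊗
  ; F-resp-≈          = λ _ _ f≈g _ → ≈-refl ⟩⊗⟨ f≈g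
  ; unitIso           = λ _ → λ⇒ †
  ; unitIso⁻¹         = λ _ → λ⇒
  ; unitIso-hom       = λ M → inverse-isMonoidHom λ-unitaryˡ λ-unitaryʳ (λ-isMonoidHom M)
  ; unitIso⁻¹-hom     = λ-isMonoidHom
  ; unitIso-isoˡ      = λ _ → λ-unitaryʳ
  ; unitIso-isoʳ      = λ _ → λ-unitaryˡ
  ; unitIso-natural   = λ _ → λ†-natural
  ; counitIso         = λ T A → MonadAtUnit.φ T A †
  ; counitIso⁻¹       = MonadAtUnit.φ
  ; counitIso-mor     = MonadAtUnit.φ†-isStrongMonadMorphism
  ; counitIso⁻¹-mor   = MonadAtUnit.φ-isStrongMonadMorphism
  ; counitIso-isoˡ    = λ T _ → unitaryʳ (MonadAtUnit.φ-unitary T)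
  ; counitIso-isoʳ    = λ T _ → unitaryˡ (MonadAtUnit.φ-unitary T)
  ; counitIso-natural = φ†-natural
  }
  where open Properties 𝒞
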